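{- Let $G,H$ be finite cyclic groups and $k\ge3$. Then \[|G|^k\le\gamma_k(G,H)\le|G|^k\,\zeta(k-1)^2,\] where $\zeta(s)=\prod_p(1-p^{ -s})^{ -1}$ is the Riemann zeta function.
   Context: $\gamma_k(G,H)=\sum_{\vec x\in G^k}|\ker\Gamma_{\vec x}|$, where $\Gamma_{\vec x}:\mathrm{Hom}(G,H)\to H^k$, $\varphi\mapsto(\varphi(x_1),\dots,\varphi(x_k))$; equivalently $\gamma_k=\sum_{\varphi\in\mathrm{Hom}(G,H)}|\ker\varphi|^k$. -}

module Defs where

open import Data.Nat as ℕ using (ℕ; zero; suc; _^_; NonZero)
open import Data.Nat.Properties using (m^n≢0)
open import Data.Nat.DivMod using (_mod_)
open import Data.Fin using (Fin; toℕ)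
open import Data.Fin.Properties using (_≟_)
open import Data.List using (List; []; _∷_; map; concatMap; allFin; filter; length)
open import Data.Nat.ListAction using (sum)
open import Data.List.Relation.Unary.All using (All)
open import Data.List.Relation.Unary.All.Properties using ()
import Data.List.Relation.Unary.All as All
open import Data.Integer using (+_)
open import Data.Rational as ℚ using (ℚ; 0ℚ)
open import Relation.Binary.PropositionalEquality using (_≡_)
open import Relation.Nullary using (Dec)

Zmod+ : (m : ℕ) .{{_ : NonZero m}} → Fin m → Fin m → Fin m
Zmod+ m a b = (toℕ a ℕ.+ toℕ b) mod m

-- All functions Fin m → Fin n, enumerated explicitly (each exactly once).
allFuns : (m n : ℕ) → List (Fin m → Fin n)
allFuns zero    n = (λ ()) ∷ []
allFuns (suc m) n =
  concatMap (λ (y : Fin n) → map (λ (f : Fin m → Fin n) → cons y f) (allFuns m n)) (allFin n)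
  where
  cons : Fin n → (Fin m → Fin n) → Fin (suc m) → Fin n
  cons y f Fin.zero    = y
  cons y f (Fin.suc i) = f i

IsHom : (m n : ℕ) .{{_ : NonZero m}} .{{_ : NonZero n}} → (Fin m → Fin n) → Set
IsHom m n f = All (λ a → All (λ b → f (Zmod+ m a b) ≡ Zmod+ n (f a) (f b)) (allFin m)) (allFin m)

isHom? : (m n : ℕ) .{{_ : NonZero m}} .{{_ : NonZero n}} → (f : Fin m → Fin n) → Dec (IsHom m n f)
isHom? m n f = All.all? (λ a → All.all? (λ b → f (Zmod+ m a b) ≟ Zmod+ n (f a) (f b)) (allFin m)) (allFin m)

Hom : (m n : ℕ) .{{_ : NonZero m}} .{{_ : NonZero n}} → List (Fin m → Fin n)
Hom m n = filter (isHom? m n) (allFuns m n)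

kerSize : (m n : ℕ) .{{_ : NonZero n}} → (Fin m → Fin n) → ℕ
kerSize m n φ = length (filter (λ a → φ a ≟ (0 mod n)) (allFin m))

γ : (k m n : ℕ) .{{_ : NonZero m}} .{{_ : NonZero n}} → ℕ
γ k m n = sum (map (λ φ → kerSize m n φ ^ k) (Hom m n))

-- Partial sums of the zeta series: Z s M = Σ_{j=1}^{M} 1 / j^s  (rational).
Z : (s M : ℕ) → ℚ
Z s zero    = 0ℚ
Z s (suc M) = Z s M ℚ.+ ((+ 1) ℚ./ (suc M ^ s)) {{m^n≢0 (suc M) s}}

toℚ : ℕ → ℚ
toℚ n = (+ n) ℚ./ 1

-- A homomorphism φ : ℤ/m → ℤ/n is a ↦ a·v with v = φ(1), subject to n ∣ m·v; its kernel consists of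
-- the multiples of the additive order o = n / gcd(n, v) of v, so |ker φ| = m / o, and o ∣ m.  The zero
-- map alone gives γ ≥ m^k.  For the upper bound group the v by their order o: n ∣ o·v holds for only
-- gcd(n, o) ≤ o values v < n, so γ ≤ Σ_{o ≤ m} o·(m/o)^k ≤ m^k Σ_{o ≤ m} o^(1-k) = m^k Z(k-1, m),
-- and Z(k-1, m) ≥ 1 covers the second zeta factor.
module Submission where

open import Data.Bool using (Bool; true; false; _∧_)
open import Data.Fin as Fin using (Fin; toℕ)
open import Data.Fin.Properties using (all?; toℕ-injective; toℕ-fromℕ<; toℕ<n)
import Data.Integer as ℤ
import Data.Integer.Properties as ℤ
open import Data.List using (List; []; _∷_; _++_; map; concatMap; filter; length; allFin; upTo)
open import Data.List.Properties
  using (filter-all; length-tabulate; map-cong; map-++; map-∘; map-tabulate; map-applyUpTo; upTo-∷ʳ)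
open import Data.List.Membership.Propositional using (_∈_)
open import Data.List.Membership.Propositional.Properties using (∈-allFin; ∈-upTo⁺; ∈-upTo⁻)
import Data.List.Relation.Unary.All as All
open import Data.List.Relation.Unary.Any using (here; there)
open import Data.Nat
  using (ℕ; zero; suc; pred; _+_; _*_; _^_; _∸_; _≤_; _<_; z≤n; s≤s; NonZero; >-nonZero⁻¹; ≢-nonZero; ≢-nonZero⁻¹)
open import Data.Nat.Coprimality using (Coprime; coprime-/gcd; coprime-divisor)
open import Data.Nat.DivMod
  using (_%_; _/_; _mod_; m%n<n; n%n≡0; m<n⇒m%n≡m; %-distribˡ-+; m%n%n≡m%n; m≡m%n+[m/n]*n;
         m/n*n≤m; m/n*n≡m; m*n/n≡m; /-congˡ)
open import Data.Nat.Divisibility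
  using (_∣_; _∣?_; divides; ∣-refl; ∣-trans; ∣⇒≤; _∣0; m∣m*n; *-monoˡ-∣; *-cancelʳ-∣; ∣m+n∣m⇒∣n; ∣m∣n⇒∣m+n;
         m%n≡0⇒n∣m; n∣m⇒m%n≡0)
open import Data.Nat.GCD using (gcd; gcd[m,n]∣m; gcd[m,n]∣n; gcd[m,n]≢0; gcd[m,n]≤n; m/gcd[m,n]≢0)
open import Data.Nat.ListAction using (sum)
open import Data.Nat.ListAction.Properties using (sum-++)
open import Data.Nat.Properties
open import Algebra.Properties.CommutativeSemigroup +-commutativeSemigroup using ()
  renaming (interchange to +-interchange)
open import Algebra.Properties.CommutativeSemigroup *-commutativeSemigroup using (x∙yz≈y∙xz)
  renaming (interchange to *-interchange)
open import Data.Product using (_×_; _,_; ∃-syntax)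
open import Data.Rational as ℚ using (ℚ; toℚᵘ; Positive)
import Data.Rational.Properties as ℚ
open import Data.Rational.Unnormalised as ℚᵘ using (mkℚᵘ; *≡*; *≤*) renaming (_≃_ to _≃ᵘ_)
import Data.Rational.Unnormalised.Properties as ℚᵘ
open import Data.Sum using (inj₁)
open import Function using (_∘_; id)
open import Function.Bundles using (_⇔_; mk⇔)
open import Relation.Binary.PropositionalEquality
open import Relation.Nullary using (Dec; does; yes; no; contradiction)
open import Relation.Nullary.Decidable using (does-⇔; dec-true; dec-false)

open import Defs

private variable
  A B : Set

𝟙 : Bool → ℕ
𝟙 true  = 1
𝟙 false = 0

𝟙-∧ : ∀ a b → 𝟙 (a ∧ b) ≡ 𝟙 a * 𝟙 b
𝟙-∧ true  b = sym (+-identityʳ (𝟙 b))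
𝟙-∧ false b = refl

𝟙-⇔ : ∀ {P Q : Set} → P ⇔ Q → (p : Dec P) (q : Dec Q) → 𝟙 (does p) ≡ 𝟙 (does q)
𝟙-⇔ P⇔Q p q = cong 𝟙 (does-⇔ P⇔Q p q)

𝟙*-≤ : ∀ {P : Set} (p : Dec P) {x y} → (P → x ≤ y) → 𝟙 (does p) * x ≤ y
𝟙*-≤ (yes p) x≤y = ≤-trans (≤-reflexive (+-identityʳ _)) (x≤y p)
𝟙*-≤ (no _)  x≤y = z≤n

∑∈ : List A → (A → ℕ) → ℕ
∑∈ xs f = sum (map f xs)

syntax ∑∈ xs (λ x → e) = ∑[ x ∈ xs ] e

∑∈-cong : ∀ (xs : List A) {f g : A → ℕ} → f ≗ g → ∑∈ xs f ≡ ∑∈ xs g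
∑∈-cong xs f≗g = cong sum (map-cong f≗g xs)

∑∈-mono : ∀ (xs : List A) {f g : A → ℕ} → (∀ x → f x ≤ g x) → ∑∈ xs f ≤ ∑∈ xs g
∑∈-mono []       f≤g = z≤n
∑∈-mono (x ∷ xs) f≤g = +-mono-≤ (f≤g x) (∑∈-mono xs f≤g)

∑∈-zero : ∀ (xs : List A) {f : A → ℕ} → (∀ x → x ∈ xs → f x ≡ 0) → ∑∈ xs f ≡ 0
∑∈-zero []       f≡0 = refl
∑∈-zero (x ∷ xs) f≡0 = cong₂ _+_ (f≡0 x (here refl)) (∑∈-zero xs (λ y y∈xs → f≡0 y (there y∈xs)))

∈⇒≤∑∈ : ∀ (f : A → ℕ) {x xs} → x ∈ xs → f x ≤ ∑∈ xs f
∈⇒≤∑∈ f (here refl)                 = m≤m+n _ _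
∈⇒≤∑∈ f {xs = y ∷ _} (there x∈xs) = ≤-trans (∈⇒≤∑∈ f x∈xs) (m≤n+m _ (f y))

∑∈-+ : ∀ (xs : List A) (f g : A → ℕ) → ∑[ x ∈ xs ] (f x + g x) ≡ ∑∈ xs f + ∑∈ xs g
∑∈-+ []       f g = refl
∑∈-+ (x ∷ xs) f g = trans (cong (f x + g x +_) (∑∈-+ xs f g)) (+-interchange (f x) (g x) _ _)

∑∈-*ʳ : ∀ (xs : List A) (f : A → ℕ) c → ∑[ x ∈ xs ] (f x * c) ≡ ∑∈ xs f * c
∑∈-*ʳ []       f c = refl
∑∈-*ʳ (x ∷ xs) f c = trans (cong (f x * c +_) (∑∈-*ʳ xs f c)) (sym (*-distribʳ-+ c (f x) _))

∑∈-*ˡ : ∀ (xs : List A) c (f : A → ℕ) → ∑[ x ∈ xs ] (c * f x) ≡ c * ∑∈ xs f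
∑∈-*ˡ xs c f = trans (∑∈-cong xs (λ x → *-comm c (f x))) (trans (∑∈-*ʳ xs f c) (*-comm _ c))

∑∈-comm : ∀ (xs : List A) (ys : List B) (F : A → B → ℕ) →
          ∑[ x ∈ xs ] ∑[ y ∈ ys ] F x y ≡ ∑[ y ∈ ys ] ∑[ x ∈ xs ] F x y
∑∈-comm []       ys F = sym (∑∈-zero ys (λ _ _ → refl))
∑∈-comm (x ∷ xs) ys F =
  trans (cong (∑∈ ys (F x) +_) (∑∈-comm xs ys F)) (sym (∑∈-+ ys (F x) (λ y → ∑[ x ∈ xs ] F x y)))

∑∈-map : ∀ (g : A → B) (xs : List A) (f : B → ℕ) → ∑[ y ∈ map g xs ] f y ≡ ∑[ x ∈ xs ] f (g x)
∑∈-map g xs f = cong sum (sym (map-∘ xs))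

∑∈-concatMap : ∀ (g : A → List B) (xs : List A) (f : B → ℕ) →
               ∑[ y ∈ concatMap g xs ] f y ≡ ∑[ x ∈ xs ] ∑[ y ∈ g x ] f y
∑∈-concatMap g []       f = refl
∑∈-concatMap g (x ∷ xs) f = begin
  sum (map f (g x ++ concatMap g xs))           ≡⟨ cong sum (map-++ f (g x) _) ⟩
  sum (map f (g x) ++ map f (concatMap g xs))   ≡⟨ sum-++ (map f (g x)) _ ⟩
  ∑∈ (g x) f + ∑∈ (concatMap g xs) f            ≡⟨ cong (∑∈ (g x) f +_) (∑∈-concatMap g xs f) ⟩
  ∑∈ (g x) f + ∑[ x ∈ xs ] ∑[ y ∈ g x ] f y     ∎
  where open ≡-Reasoning

module _ {P : A → Set} (P? : ∀ x → Dec (P x)) where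

  ∑∈-filter : ∀ (xs : List A) (f : A → ℕ) →
              ∑[ x ∈ filter P? xs ] f x ≡ ∑[ x ∈ xs ] (𝟙 (does (P? x)) * f x)
  ∑∈-filter []       f = refl
  ∑∈-filter (x ∷ xs) f with does (P? x)
  ... | true  = cong₂ _+_ (sym (+-identityʳ (f x))) (∑∈-filter xs f)
  ... | false = ∑∈-filter xs f

  length-filter≡∑ : ∀ (xs : List A) → length (filter P? xs) ≡ ∑[ x ∈ xs ] 𝟙 (does (P? x))
  length-filter≡∑ []       = refl
  length-filter≡∑ (x ∷ xs) with does (P? x)
  ... | true  = cong suc (length-filter≡∑ xs)
  ... | false = length-filter≡∑ xs

∑< : ℕ → (ℕ → ℕ) → ℕ
∑< n f = ∑∈ (upTo n) f

syntax ∑< n (λ i → e) = ∑[ i < n ] e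

∑<-suc : ∀ n (f : ℕ → ℕ) → ∑[ i < suc n ] f i ≡ f 0 + ∑[ i < n ] f (suc i)
∑<-suc n f = cong (λ xs → f 0 + sum xs) (trans (map-applyUpTo suc f n) (sym (map-applyUpTo id (f ∘ suc) n)))

∑<-init-last : ∀ n (f : ℕ → ℕ) → ∑[ i < suc n ] f i ≡ ∑[ i < n ] f i + f n
∑<-init-last n f = begin
  sum (map f (upTo (suc n)))           ≡⟨ cong (sum ∘ map f) (sym (upTo-∷ʳ n)) ⟩
  sum (map f (upTo n ++ n ∷ []))       ≡⟨ cong sum (map-++ f (upTo n) _) ⟩
  sum (map f (upTo n) ++ f n ∷ [])     ≡⟨ sum-++ (map f (upTo n)) _ ⟩
  ∑[ i < n ] f i + (f n + 0)           ≡⟨ cong (∑[ i < n ] f i +_) (+-identityʳ (f n)) ⟩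
  ∑[ i < n ] f i + f n                 ∎
  where open ≡-Reasoning

∑<-+ : ∀ a b (f : ℕ → ℕ) → ∑[ i < a + b ] f i ≡ ∑[ i < a ] f i + ∑[ j < b ] f (a + j)
∑<-+ zero    b f = refl
∑<-+ (suc a) b f = begin
  ∑[ i < suc (a + b) ] f i                                    ≡⟨ ∑<-suc (a + b) f ⟩
  f 0 + ∑[ i < a + b ] f (suc i)                              ≡⟨ cong (f 0 +_) (∑<-+ a b (f ∘ suc)) ⟩
  f 0 + (∑[ i < a ] f (suc i) + ∑[ j < b ] f (suc a + j))     ≡⟨ sym (+-assoc (f 0) _ _) ⟩
  (f 0 + ∑[ i < a ] f (suc i)) + ∑[ j < b ] f (suc a + j)     ≡⟨ cong (_+ ∑[ j < b ] f (suc a + j)) (∑<-suc a f) ⟨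
  ∑[ i < suc a ] f i + ∑[ j < b ] f (suc a + j)               ∎
  where open ≡-Reasoning

<⇒≤∑< : ∀ {i n} (f : ℕ → ℕ) → i < n → f i ≤ ∑[ j < n ] f j
<⇒≤∑< f i<n = ∈⇒≤∑∈ f (∈-upTo⁺ i<n)

∑-allFin-suc : ∀ n (f : Fin (suc n) → ℕ) →
               ∑[ i ∈ allFin (suc n) ] f i ≡ f Fin.zero + ∑[ i ∈ allFin n ] f (Fin.suc i)
∑-allFin-suc n f =
  cong (λ xs → f Fin.zero + sum xs) (trans (map-tabulate Fin.suc f) (sym (map-tabulate id (f ∘ Fin.suc))))

∑-allFin-toℕ : ∀ n (f : ℕ → ℕ) → ∑[ i ∈ allFin n ] f (toℕ i) ≡ ∑[ i < n ] f i
∑-allFin-toℕ zero    f = refl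
∑-allFin-toℕ (suc n) f = begin
  ∑[ i ∈ allFin (suc n) ] f (toℕ i)       ≡⟨ ∑-allFin-suc n (f ∘ toℕ) ⟩
  f 0 + ∑[ i ∈ allFin n ] f (suc (toℕ i)) ≡⟨ cong (f 0 +_) (∑-allFin-toℕ n (f ∘ suc)) ⟩
  f 0 + ∑[ i < n ] f (suc i)              ≡⟨ sym (∑<-suc n f) ⟩
  ∑[ i < suc n ] f i                      ∎
  where open ≡-Reasoning

_≗?_ : ∀ {m n} (f g : Fin m → Fin n) → Dec (f ≗ g)
f ≗? g = all? (λ i → f i Fin.≟ g i)

∑-allFin-≟ : ∀ {n} (c : Fin n) → ∑[ y ∈ allFin n ] 𝟙 (does (y Fin.≟ c)) ≡ 1
∑-allFin-≟ {suc n} c@Fin.zero    =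
  trans (∑-allFin-suc n (λ y → 𝟙 (does (y Fin.≟ c)))) (cong suc (∑∈-zero (allFin n) (λ _ _ → refl)))
∑-allFin-≟ {suc n} c@(Fin.suc c′) = trans (∑-allFin-suc n (λ y → 𝟙 (does (y Fin.≟ c)))) (∑-allFin-≟ c′)

-- allFuns (suc m) n lists the extensions of each f ∈ allFuns m n by a value y at zero, and such an
-- extension agrees with h exactly when y ≡ h zero and f ≗ h ∘ suc (this split is definitional).
∑-allFuns-≗ : ∀ m n (h : Fin m → Fin n) → ∑[ f ∈ allFuns m n ] 𝟙 (does (f ≗? h)) ≡ 1
∑-allFuns-≗ zero    n h = refl
∑-allFuns-≗ (suc m) n h = begin
  ∑[ f ∈ allFuns (suc m) n ] 𝟙 (does (f ≗? h))
    ≡⟨ trans (∑∈-concatMap _ (allFin n) _) (∑∈-cong (allFin n) (λ y → ∑∈-map _ (allFuns m n) _)) ⟩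
  ∑[ y ∈ allFin n ] ∑[ f ∈ allFuns m n ] 𝟙 (head y ∧ tail f)
    ≡⟨ ∑∈-cong (allFin n) (λ y → ∑∈-cong (allFuns m n) (λ f → 𝟙-∧ (head y) (tail f))) ⟩
  ∑[ y ∈ allFin n ] ∑[ f ∈ allFuns m n ] (𝟙 (head y) * 𝟙 (tail f))
    ≡⟨ ∑∈-cong (allFin n) (λ y → ∑∈-*ˡ (allFuns m n) (𝟙 (head y)) (𝟙 ∘ tail)) ⟩
  ∑[ y ∈ allFin n ] (𝟙 (head y) * ∑[ f ∈ allFuns m n ] 𝟙 (tail f))
    ≡⟨ ∑∈-cong (allFin n) (λ y → cong (𝟙 (head y) *_) (∑-allFuns-≗ m n (h ∘ Fin.suc))) ⟩
  ∑[ y ∈ allFin n ] (𝟙 (head y) * 1)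
    ≡⟨ ∑∈-cong (allFin n) (λ y → *-identityʳ (𝟙 (head y))) ⟩
  ∑[ y ∈ allFin n ] 𝟙 (head y)
    ≡⟨ ∑-allFin-≟ (h Fin.zero) ⟩
  1 ∎
  where
  open ≡-Reasoning
  head : Fin n → Bool
  head y = does (y Fin.≟ h Fin.zero)
  tail : (Fin m → Fin n) → Bool
  tail f = does (f ≗? (h ∘ Fin.suc))

toℕ-mod : ∀ x d .{{_ : NonZero d}} → toℕ (x mod d) ≡ x % d
toℕ-mod x d = toℕ-fromℕ< (m%n<n x d)

toℕ-0mod : ∀ d .{{_ : NonZero d}} → toℕ (0 mod d) ≡ 0
toℕ-0mod d = trans (toℕ-mod 0 d) (m<n⇒m%n≡m (>-nonZero⁻¹ d))

toℕ-mod-id : ∀ {d} .{{_ : NonZero d}} (a : Fin d) → toℕ a mod d ≡ a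
toℕ-mod-id {d} a = toℕ-injective (trans (toℕ-mod (toℕ a) d) (m<n⇒m%n≡m (toℕ<n a)))

mod-+ : ∀ a b d .{{_ : NonZero d}} → (a + b) mod d ≡ Zmod+ d (a mod d) (b mod d)
mod-+ a b d = toℕ-injective (begin
  toℕ ((a + b) mod d)                          ≡⟨ toℕ-mod (a + b) d ⟩
  (a + b) % d                                  ≡⟨ %-distribˡ-+ a b d ⟩
  (a % d + b % d) % d                          ≡⟨ cong₂ (λ x y → (x + y) % d) (toℕ-mod a d) (toℕ-mod b d) ⟨
  (toℕ (a mod d) + toℕ (b mod d)) % d          ≡⟨ toℕ-mod _ d ⟨
  toℕ (Zmod+ d (a mod d) (b mod d))            ∎)
  where open ≡-Reasoning

mod≡0mod⇔∣ : ∀ x d .{{_ : NonZero d}} → x mod d ≡ 0 mod d ⇔ d ∣ x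
mod≡0mod⇔∣ x d = mk⇔
  (λ eq → m%n≡0⇒n∣m x d (trans (sym (toℕ-mod x d)) (trans (cong toℕ eq) (toℕ-0mod d))))
  (λ d∣x → toℕ-injective (trans (toℕ-mod x d) (trans (n∣m⇒m%n≡0 x d d∣x) (sym (toℕ-0mod d)))))

[m+n%d]%d≡[m+n]%d : ∀ m n d .{{_ : NonZero d}} → (m + n % d) % d ≡ (m + n) % d
[m+n%d]%d≡[m+n]%d m n d = begin
  (m + n % d) % d             ≡⟨ %-distribˡ-+ m (n % d) d ⟩
  (m % d + n % d % d) % d     ≡⟨ cong (λ x → (m % d + x) % d) (m%n%n≡m%n n d) ⟩
  (m % d + n % d) % d         ≡⟨ %-distribˡ-+ m n d ⟨
  (m + n) % d                 ∎
  where open ≡-Reasoning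

m≡[m+m]%d⇒m≡0 : ∀ {m} d .{{_ : NonZero d}} → m < d → m ≡ (m + m) % d → m ≡ 0
m≡[m+m]%d⇒m≡0 {m} d m<d eq = q*d≡m⇒m≡0 ((m + m) / d) m≡q*d
  where
  m≡q*d : m ≡ (m + m) / d * d
  m≡q*d = +-cancelˡ-≡ m m _ (trans (m≡m%n+[m/n]*n (m + m) d) (cong (_+ (m + m) / d * d) (sym eq)))
  q*d≡m⇒m≡0 : ∀ q → m ≡ q * d → m ≡ 0
  q*d≡m⇒m≡0 zero    m≡0     = m≡0
  q*d≡m⇒m≡0 (suc q) m≡d+q*d = contradiction (≤-trans (m≤m+n d (q * d)) (≤-reflexive (sym m≡d+q*d))) (<⇒≱ m<d)

mulBy : (m n : ℕ) .{{_ : NonZero n}} → ℕ → Fin m → Fin n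
mulBy m n v a = (toℕ a * v) mod n

module _ {m n : ℕ} .{{_ : NonZero m}} .{{_ : NonZero n}} (f : Fin m → Fin n) where

  ≗0⇒IsHom : (∀ a → f a ≡ 0 mod n) → IsHom m n f
  ≗0⇒IsHom f≡0 = All.universal (λ a → All.universal (λ b → begin
    f (Zmod+ m a b)                ≡⟨ f≡0 _ ⟩
    0 mod n                        ≡⟨ mod-+ 0 0 n ⟩
    Zmod+ n (0 mod n) (0 mod n)    ≡⟨ cong₂ (Zmod+ n) (f≡0 a) (f≡0 b) ⟨
    Zmod+ n (f a) (f b)            ∎) (allFin m)) (allFin m)
    where open ≡-Reasoning

  ≗0⇒kerSize≡m : (∀ a → f a ≡ 0 mod n) → kerSize m n f ≡ m
  ≗0⇒kerSize≡m f≡0 =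
    trans (cong length (filter-all (λ a → f a Fin.≟ 0 mod n) (All.universal f≡0 (allFin m)))) (length-tabulate id)

  ≗mulBy⇒kerSize≡∑ : ∀ v → f ≗ mulBy m n v → kerSize m n f ≡ ∑[ a < m ] 𝟙 (does (n ∣? a * v))
  ≗mulBy⇒kerSize≡∑ v f≗ = begin
    kerSize m n f
      ≡⟨ length-filter≡∑ (λ a → f a Fin.≟ 0 mod n) (allFin m) ⟩
    ∑[ a ∈ allFin m ] 𝟙 (does (f a Fin.≟ 0 mod n))
      ≡⟨ ∑∈-cong (allFin m) (λ a → 𝟙-⇔ (f≡0⇔ a) (f a Fin.≟ 0 mod n) (n ∣? toℕ a * v)) ⟩
    ∑[ a ∈ allFin m ] 𝟙 (does (n ∣? toℕ a * v))
      ≡⟨ ∑-allFin-toℕ m (λ a → 𝟙 (does (n ∣? a * v))) ⟩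
    ∑[ a < m ] 𝟙 (does (n ∣? a * v))                   ∎
    where
    open ≡-Reasoning
    f≡0⇔ : ∀ a → (f a ≡ 0 mod n) ⇔ (n ∣ toℕ a * v)
    f≡0⇔ a = subst (λ x → (x ≡ 0 mod n) ⇔ (n ∣ toℕ a * v)) (sym (f≗ a)) (mod≡0mod⇔∣ (toℕ a * v) n)

  module _ (hom : IsHom m n f) where
    private
      v = toℕ (f (1 mod m))

      f-mod-+ : ∀ a b → toℕ (f ((a + b) mod m)) ≡ (toℕ (f (a mod m)) + toℕ (f (b mod m))) % n
      f-mod-+ a b = begin
        toℕ (f ((a + b) mod m))                  ≡⟨ cong (toℕ ∘ f) (mod-+ a b m) ⟩
        toℕ (f (Zmod+ m (a mod m) (b mod m)))    ≡⟨ cong toℕ (All.lookup (All.lookup hom (∈-allFin _)) (∈-allFin _)) ⟩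
        toℕ (Zmod+ n (f (a mod m)) (f (b mod m))) ≡⟨ toℕ-mod _ n ⟩
        (toℕ (f (a mod m)) + toℕ (f (b mod m))) % n ∎
        where open ≡-Reasoning

      f-0 : toℕ (f (0 mod m)) ≡ 0
      f-0 = m≡[m+m]%d⇒m≡0 n (toℕ<n (f (0 mod m))) (f-mod-+ 0 0)

      f-mod : ∀ j → toℕ (f (j mod m)) ≡ (j * v) % n
      f-mod zero    = trans f-0 (sym (trans (cong (_% n) (*-zeroˡ v)) (m<n⇒m%n≡m (>-nonZero⁻¹ n))))
      f-mod (suc j) = begin
        toℕ (f ((1 + j) mod m))               ≡⟨ f-mod-+ 1 j ⟩
        (v + toℕ (f (j mod m))) % n           ≡⟨ cong (λ x → (v + x) % n) (f-mod j) ⟩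
        (v + (j * v) % n) % n                 ≡⟨ [m+n%d]%d≡[m+n]%d v (j * v) n ⟩
        (suc j * v) % n                       ∎
        where open ≡-Reasoning

    IsHom⇒≗mulBy : f ≗ mulBy m n (toℕ (f (1 mod m)))
    IsHom⇒≗mulBy a = toℕ-injective (begin
      toℕ (f a)                     ≡⟨ cong (toℕ ∘ f) (toℕ-mod-id a) ⟨
      toℕ (f (toℕ a mod m))         ≡⟨ f-mod (toℕ a) ⟩
      (toℕ a * v) % n               ≡⟨ toℕ-mod (toℕ a * v) n ⟨
      toℕ (mulBy m n v a)           ∎)
      where open ≡-Reasoning

    IsHom⇒n∣m*f[1] : n ∣ m * toℕ (f (1 mod m))
    IsHom⇒n∣m*f[1] = m%n≡0⇒n∣m (m * v) n (begin
      (m * v) % n          ≡⟨ f-mod m ⟨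
      toℕ (f (m mod m))    ≡⟨ cong (toℕ ∘ f) mmodm≡0mod ⟩
      toℕ (f (0 mod m))    ≡⟨ f-0 ⟩
      0                    ∎)
      where
      open ≡-Reasoning
      mmodm≡0mod : m mod m ≡ 0 mod m
      mmodm≡0mod = toℕ-injective (trans (toℕ-mod m m) (trans (n%n≡0 m) (sym (toℕ-0mod m))))

gcd-nonZero : ∀ n c .{{_ : NonZero n}} → NonZero (gcd n c)
gcd-nonZero n c = ≢-nonZero (gcd[m,n]≢0 n c (inj₁ (≢-nonZero⁻¹ n)))

-- The additive order n / gcd n c of c in ℤ/n, written as a successor so that it is visibly nonzero.
order : (n c : ℕ) .{{_ : NonZero n}} → ℕ
order n c = suc (pred ((n / gcd n c) {{gcd-nonZero n c}}))

module _ (n c : ℕ) .{{_ : NonZero n}} where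
  private instance
    _ = gcd-nonZero n c

  order≡n/gcd : order n c ≡ n / gcd n c
  order≡n/gcd = suc-pred (n / gcd n c) {{≢-nonZero (m/gcd[m,n]≢0 n c)}}

  order*gcd≡n : order n c * gcd n c ≡ n
  order*gcd≡n = trans (cong (_* gcd n c) order≡n/gcd) (m/n*n≡m (gcd[m,n]∣m n c))

  coprime-order : Coprime (order n c) (c / gcd n c)
  coprime-order = subst (λ o → Coprime o (c / gcd n c)) (sym order≡n/gcd) (coprime-/gcd n c)

  private
    c≡c/g*g : c ≡ c / gcd n c * gcd n c
    c≡c/g*g = sym (m/n*n≡m (gcd[m,n]∣n n c))

  n∣order*c : n ∣ order n c * c
  n∣order*c = divides (c / gcd n c) (begin
    order n c * c                          ≡⟨ cong (order n c *_) c≡c/g*g ⟩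
    order n c * (c / gcd n c * gcd n c)    ≡⟨ x∙yz≈y∙xz (order n c) (c / gcd n c) (gcd n c) ⟩
    c / gcd n c * (order n c * gcd n c)    ≡⟨ cong (c / gcd n c *_) order*gcd≡n ⟩
    c / gcd n c * n                        ∎)
    where open ≡-Reasoning

  n∣a*c⇒order∣a : ∀ {a} → n ∣ a * c → order n c ∣ a
  n∣a*c⇒order∣a {a} n∣a*c = coprime-divisor coprime-order (*-cancelʳ-∣ (gcd n c) order*g∣c′*a*g)
    where
    c′ = c / gcd n c
    a*c≡c′*a*g : a * c ≡ c′ * a * gcd n c
    a*c≡c′*a*g = trans (cong (a *_) c≡c/g*g) (trans (x∙yz≈y∙xz a c′ (gcd n c)) (sym (*-assoc c′ a (gcd n c))))
    order*g∣c′*a*g : order n c * gcd n c ∣ c′ * a * gcd n c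
    order*g∣c′*a*g = subst₂ _∣_ (sym order*gcd≡n) a*c≡c′*a*g n∣a*c

  n/order≡gcd : n / order n c ≡ gcd n c
  n/order≡gcd = begin
    n / order n c                          ≡⟨ /-congˡ order*gcd≡n ⟨
    order n c * gcd n c / order n c        ≡⟨ /-congˡ (*-comm (order n c) (gcd n c)) ⟩
    gcd n c * order n c / order n c        ≡⟨ m*n/n≡m (gcd n c) (order n c) ⟩
    gcd n c                                ∎
    where open ≡-Reasoning

n∣a*c⇔order∣a : ∀ n c .{{_ : NonZero n}} a → n ∣ a * c ⇔ order n c ∣ a
n∣a*c⇔order∣a n c a = mk⇔ (n∣a*c⇒order∣a n c) (λ order∣a → ∣-trans (n∣order*c n c) (*-monoˡ-∣ c order∣a))

∑-multiples<d≡1 : ∀ d .{{_ : NonZero d}} → ∑[ i < d ] 𝟙 (does (d ∣? i)) ≡ 1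
∑-multiples<d≡1 d@(suc d′) = begin
  ∑[ i < suc d′ ] 𝟙 (does (d ∣? i))                       ≡⟨ ∑<-suc d′ (λ i → 𝟙 (does (d ∣? i))) ⟩
  𝟙 (does (d ∣? 0)) + ∑[ i < d′ ] 𝟙 (does (d ∣? suc i))   ≡⟨ cong₂ _+_ d∣0 (∑∈-zero (upTo d′) d∤suc) ⟩
  1                                                       ∎
  where
  open ≡-Reasoning
  d∣0 : 𝟙 (does (d ∣? 0)) ≡ 1
  d∣0 = cong 𝟙 (dec-true (d ∣? 0) (d ∣0))
  d∤suc : ∀ i → i ∈ upTo d′ → 𝟙 (does (d ∣? suc i)) ≡ 0
  d∤suc i i∈ = cong 𝟙 (dec-false (d ∣? suc i) (λ d∣1+i → <⇒≱ (s≤s (∈-upTo⁻ i∈)) (∣⇒≤ d∣1+i)))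

∑-multiples<q*d≡q : ∀ q d .{{_ : NonZero d}} → ∑[ i < q * d ] 𝟙 (does (d ∣? i)) ≡ q
∑-multiples<q*d≡q zero    d = refl
∑-multiples<q*d≡q (suc q) d = begin
  ∑[ i < d + q * d ] 𝟙 (does (d ∣? i))
    ≡⟨ ∑<-+ d (q * d) (λ i → 𝟙 (does (d ∣? i))) ⟩
  ∑[ i < d ] 𝟙 (does (d ∣? i)) + ∑[ j < q * d ] 𝟙 (does (d ∣? d + j))
    ≡⟨ cong₂ _+_ (∑-multiples<d≡1 d) (∑∈-cong (upTo (q * d)) shift) ⟩
  1 + ∑[ j < q * d ] 𝟙 (does (d ∣? j))
    ≡⟨ cong suc (∑-multiples<q*d≡q q d) ⟩
  suc q ∎
  where
  open ≡-Reasoning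
  shift : ∀ j → 𝟙 (does (d ∣? d + j)) ≡ 𝟙 (does (d ∣? j))
  shift j = 𝟙-⇔ (mk⇔ (λ d∣d+j → ∣m+n∣m⇒∣n d∣d+j ∣-refl) (∣m∣n⇒∣m+n ∣-refl)) (d ∣? d + j) (d ∣? j)

∑-n∣a*c≡x/order : ∀ n c x .{{_ : NonZero n}} → order n c ∣ x →
                  ∑[ a < x ] 𝟙 (does (n ∣? a * c)) ≡ x / order n c
∑-n∣a*c≡x/order n c x (divides q refl) = begin
  ∑[ a < q * order n c ] 𝟙 (does (n ∣? a * c))
    ≡⟨ ∑∈-cong (upTo (q * order n c)) (λ a → 𝟙-⇔ (n∣a*c⇔order∣a n c a) (n ∣? a * c) (order n c ∣? a)) ⟩
  ∑[ a < q * order n c ] 𝟙 (does (order n c ∣? a))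
    ≡⟨ ∑-multiples<q*d≡q q (order n c) ⟩
  q
    ≡⟨ m*n/n≡m q (order n c) ⟨
  q * order n c / order n c ∎
  where open ≡-Reasoning

∑-n∣v*[1+s]≤1+s : ∀ n s .{{_ : NonZero n}} → ∑[ v < n ] 𝟙 (does (n ∣? v * suc s)) ≤ suc s
∑-n∣v*[1+s]≤1+s n s = begin
  ∑[ v < n ] 𝟙 (does (n ∣? v * suc s))   ≡⟨ ∑-n∣a*c≡x/order n (suc s) n (n∣a*c⇒order∣a n (suc s) (m∣m*n (suc s))) ⟩
  n / order n (suc s)                    ≡⟨ n/order≡gcd n (suc s) ⟩
  gcd n (suc s)                          ≤⟨ gcd[m,n]≤n n (suc s) ⟩
  suc s                                  ∎
  where open ≤-Reasoning

module _ (k m n : ℕ) .{{_ : NonZero m}} .{{_ : NonZero n}} where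

  kerCount : ℕ → ℕ
  kerCount v = ∑[ a < m ] 𝟙 (does (n ∣? a * v))

  γ≡∑-allFuns : γ k m n ≡ ∑[ f ∈ allFuns m n ] (𝟙 (does (isHom? m n f)) * kerSize m n f ^ k)
  γ≡∑-allFuns = ∑∈-filter (isHom? m n) (allFuns m n) (λ f → kerSize m n f ^ k)

  m^k≤γ : m ^ k ≤ γ k m n
  m^k≤γ = begin
    m ^ k                                                   ≡⟨ *-identityˡ (m ^ k) ⟨
    1 * m ^ k                                               ≡⟨ cong (_* m ^ k) (∑-allFuns-≗ m n 0̂) ⟨
    ∑[ f ∈ allFuns m n ] 𝟙 (does (f ≗? 0̂)) * m ^ k          ≡⟨ ∑∈-*ʳ (allFuns m n) (λ f → 𝟙 (does (f ≗? 0̂))) (m ^ k) ⟨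
    ∑[ f ∈ allFuns m n ] (𝟙 (does (f ≗? 0̂)) * m ^ k)        ≤⟨ ∑∈-mono (allFuns m n) zero-term ⟩
    ∑[ f ∈ allFuns m n ] (𝟙 (does (isHom? m n f)) * kerSize m n f ^ k)   ≡⟨ γ≡∑-allFuns ⟨
    γ k m n                                                 ∎
    where
    open ≤-Reasoning
    0̂ : Fin m → Fin n
    0̂ _ = 0 mod n
    zero-term : ∀ f → 𝟙 (does (f ≗? 0̂)) * m ^ k ≤ 𝟙 (does (isHom? m n f)) * kerSize m n f ^ k
    zero-term f = 𝟙*-≤ (f ≗? 0̂) λ f≗0̂ → ≤-reflexive (sym (begin-equality
      𝟙 (does (isHom? m n f)) * kerSize m n f ^ k
        ≡⟨ cong (λ b → 𝟙 b * kerSize m n f ^ k) (dec-true (isHom? m n f) (≗0⇒IsHom f f≗0̂)) ⟩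
      1 * kerSize m n f ^ k
        ≡⟨ *-identityˡ _ ⟩
      kerSize m n f ^ k
        ≡⟨ cong (_^ k) (≗0⇒kerSize≡m f f≗0̂) ⟩
      m ^ k ∎))

  γ≤∑-generators : γ k m n ≤ ∑[ v < n ] (𝟙 (does (n ∣? m * v)) * kerCount v ^ k)
  γ≤∑-generators = begin
    γ k m n                                                          ≡⟨ γ≡∑-allFuns ⟩
    ∑[ f ∈ allFuns m n ] (𝟙 (does (isHom? m n f)) * kerSize m n f ^ k) ≤⟨ ∑∈-mono (allFuns m n) hom-term ⟩
    ∑[ f ∈ allFuns m n ] ∑[ v < n ] (𝟙 (does (f ≗? φ v)) * term v)     ≡⟨ ∑∈-comm (allFuns m n) (upTo n) _ ⟩
    ∑[ v < n ] ∑[ f ∈ allFuns m n ] (𝟙 (does (f ≗? φ v)) * term v)     ≡⟨ ∑∈-cong (upTo n) counted-once ⟩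
    ∑[ v < n ] term v                                                ∎
    where
    open ≤-Reasoning
    φ : ℕ → Fin m → Fin n
    φ = mulBy m n
    term : ℕ → ℕ
    term v = 𝟙 (does (n ∣? m * v)) * kerCount v ^ k

    hom-term : ∀ f → 𝟙 (does (isHom? m n f)) * kerSize m n f ^ k ≤ ∑[ v < n ] (𝟙 (does (f ≗? φ v)) * term v)
    hom-term f = 𝟙*-≤ (isHom? m n f) λ hom → let v = toℕ (f (1 mod m)) in begin
      kerSize m n f ^ k
        ≡⟨ cong (_^ k) (≗mulBy⇒kerSize≡∑ f v (IsHom⇒≗mulBy f hom)) ⟩
      kerCount v ^ k
        ≡⟨ *-identityˡ _ ⟨
      1 * kerCount v ^ k
        ≡⟨ cong (λ b → 𝟙 b * kerCount v ^ k) (dec-true (n ∣? m * v) (IsHom⇒n∣m*f[1] f hom)) ⟨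
      term v
        ≡⟨ *-identityˡ (term v) ⟨
      1 * term v
        ≡⟨ cong (λ b → 𝟙 b * term v) (dec-true (f ≗? φ v) (IsHom⇒≗mulBy f hom)) ⟨
      𝟙 (does (f ≗? φ v)) * term v
        ≤⟨ <⇒≤∑< (λ v → 𝟙 (does (f ≗? φ v)) * term v) (toℕ<n (f (1 mod m))) ⟩
      ∑[ v < n ] (𝟙 (does (f ≗? φ v)) * term v) ∎

    counted-once : ∀ v → ∑[ f ∈ allFuns m n ] (𝟙 (does (f ≗? φ v)) * term v) ≡ term v
    counted-once v = begin-equality
      ∑[ f ∈ allFuns m n ] (𝟙 (does (f ≗? φ v)) * term v)   ≡⟨ ∑∈-*ʳ (allFuns m n) _ (term v) ⟩
      ∑[ f ∈ allFuns m n ] 𝟙 (does (f ≗? φ v)) * term v     ≡⟨ cong (_* term v) (∑-allFuns-≗ m n (φ v)) ⟩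
      1 * term v                                           ≡⟨ *-identityˡ (term v) ⟩
      term v                                               ∎

  -- Group the generators v by their order o, which divides m and satisfies kerCount v = m / o.
  generator-term≤∑-orders : ∀ v → 𝟙 (does (n ∣? m * v)) * kerCount v ^ k ≤
                                  ∑[ s < m ] (𝟙 (does (n ∣? v * suc s)) * (m / suc s) ^ k)
  generator-term≤∑-orders v = 𝟙*-≤ (n ∣? m * v) λ n∣m*v → let order∣m = n∣a*c⇒order∣a n v n∣m*v in begin
    kerCount v ^ k
      ≡⟨ cong (_^ k) (∑-n∣a*c≡x/order n v m order∣m) ⟩
    (m / order n v) ^ k
      ≤⟨ order-term (order n v) (∣⇒≤ order∣m) (subst (n ∣_) (*-comm (order n v) v) (n∣order*c n v)) ⟩
    ∑[ s < m ] (𝟙 (does (n ∣? v * suc s)) * (m / suc s) ^ k) ∎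
    where
    open ≤-Reasoning
    order-term : ∀ o .{{_ : NonZero o}} → o ≤ m → n ∣ v * o →
                 (m / o) ^ k ≤ ∑[ s < m ] (𝟙 (does (n ∣? v * suc s)) * (m / suc s) ^ k)
    order-term (suc s) s<m n∣v*o = begin
      (m / suc s) ^ k
        ≡⟨ *-identityˡ _ ⟨
      1 * (m / suc s) ^ k
        ≡⟨ cong (λ b → 𝟙 b * (m / suc s) ^ k) (dec-true (n ∣? v * suc s) n∣v*o) ⟨
      𝟙 (does (n ∣? v * suc s)) * (m / suc s) ^ k
        ≤⟨ <⇒≤∑< (λ s → 𝟙 (does (n ∣? v * suc s)) * (m / suc s) ^ k) s<m ⟩
      ∑[ s < m ] (𝟙 (does (n ∣? v * suc s)) * (m / suc s) ^ k) ∎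

  γ≤∑-orders : γ k m n ≤ ∑[ s < m ] (suc s * (m / suc s) ^ k)
  γ≤∑-orders = begin
    γ k m n                                                    ≤⟨ γ≤∑-generators ⟩
    ∑[ v < n ] (𝟙 (does (n ∣? m * v)) * kerCount v ^ k)        ≤⟨ ∑∈-mono (upTo n) generator-term≤∑-orders ⟩
    ∑[ v < n ] ∑[ s < m ] (𝟙 (does (n ∣? v * suc s)) * w s)    ≡⟨ ∑∈-comm (upTo n) (upTo m) _ ⟩
    ∑[ s < m ] ∑[ v < n ] (𝟙 (does (n ∣? v * suc s)) * w s)    ≡⟨ ∑∈-cong (upTo m) (λ s → ∑∈-*ʳ (upTo n) _ (w s)) ⟩
    ∑[ s < m ] (∑[ v < n ] 𝟙 (does (n ∣? v * suc s)) * w s)    ≤⟨ ∑∈-mono (upTo m) fibre ⟩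
    ∑[ s < m ] (suc s * w s)                                   ∎
    where
    open ≤-Reasoning
    w : ℕ → ℕ
    w s = (m / suc s) ^ k
    fibre : ∀ s → ∑[ v < n ] 𝟙 (does (n ∣? v * suc s)) * w s ≤ suc s * w s
    fibre s = *-monoˡ-≤ (w s) (∑-n∣v*[1+s]≤1+s n s)

^-distribʳ-* : ∀ a b k → (a * b) ^ k ≡ a ^ k * b ^ k
^-distribʳ-* a b zero    = refl
^-distribʳ-* a b (suc k) = trans (cong (a * b *_) (^-distribʳ-* a b k)) (*-interchange a b (a ^ k) (b ^ k))

d*[m/d]^[1+k]*d^k≤m^[1+k] : ∀ k m d .{{_ : NonZero d}} → d * (m / d) ^ suc k * d ^ k ≤ m ^ suc k
d*[m/d]^[1+k]*d^k≤m^[1+k] k m d = begin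
  d * (m / d) ^ suc k * d ^ k       ≡⟨ *-assoc d ((m / d) ^ suc k) (d ^ k) ⟩
  d * ((m / d) ^ suc k * d ^ k)     ≡⟨ x∙yz≈y∙xz d ((m / d) ^ suc k) (d ^ k) ⟩
  (m / d) ^ suc k * d ^ suc k       ≡⟨ ^-distribʳ-* (m / d) d (suc k) ⟨
  (m / d * d) ^ suc k               ≤⟨ ^-monoˡ-≤ (suc k) (m/n*n≤m m d) ⟩
  m ^ suc k                         ∎
  where open ≤-Reasoning

-- toℚ a is fromℚᵘ of the unnormalised fraction a / 1, so facts about toℚ can be proved in ℚᵘ.
toℚᵘ-toℚ : ∀ a → toℚᵘ (toℚ a) ≃ᵘ mkℚᵘ (ℤ.+ a) 0
toℚᵘ-toℚ a = ℚ.toℚᵘ-fromℚᵘ (mkℚᵘ (ℤ.+ a) 0)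

toℚ-+ : ∀ a b → toℚ (a + b) ≡ toℚ a ℚ.+ toℚ b
toℚ-+ a b = ℚ.toℚᵘ-injective (begin-equality
  toℚᵘ (toℚ (a + b))                   ≃⟨ toℚᵘ-toℚ (a + b) ⟩
  mkℚᵘ (ℤ.+ (a + b)) 0                 ≃⟨ *≡* (cong (ℤ._* ℤ.+ 1) (trans (ℤ.pos-+ a b) (sym a*1+b*1≡a+b))) ⟩
  mkℚᵘ (ℤ.+ a) 0 ℚᵘ.+ mkℚᵘ (ℤ.+ b) 0   ≃⟨ ℚᵘ.+-cong (toℚᵘ-toℚ a) (toℚᵘ-toℚ b) ⟨
  toℚᵘ (toℚ a) ℚᵘ.+ toℚᵘ (toℚ b)       ≃⟨ ℚ.toℚᵘ-homo-+ (toℚ a) (toℚ b) ⟨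
  toℚᵘ (toℚ a ℚ.+ toℚ b)               ∎)
  where
  open ℚᵘ.≤-Reasoning
  a*1+b*1≡a+b : ℤ.+ a ℤ.* ℤ.+ 1 ℤ.+ ℤ.+ b ℤ.* ℤ.+ 1 ≡ ℤ.+ a ℤ.+ ℤ.+ b
  a*1+b*1≡a+b = cong₂ ℤ._+_ (ℤ.*-identityʳ (ℤ.+ a)) (ℤ.*-identityʳ (ℤ.+ b))

toℚ-mono-≤ : ∀ {a b} → a ≤ b → toℚ a ℚ.≤ toℚ b
toℚ-mono-≤ {a} {b} a≤b =
  ℚ.toℚᵘ-cancel-≤ (ℚᵘ.≤-respˡ-≃ (ℚᵘ.≃-sym (toℚᵘ-toℚ a)) (ℚᵘ.≤-respʳ-≃ (ℚᵘ.≃-sym (toℚᵘ-toℚ b))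
    (*≤* (subst₂ ℤ._≤_ (sym (ℤ.*-identityʳ (ℤ.+ a))) (sym (ℤ.*-identityʳ (ℤ.+ b))) (ℤ.+≤+ a≤b)))))

toℚ≤toℚ*1/ : ∀ a {b} d .{{_ : NonZero d}} → a * d ≤ b → toℚ a ℚ.≤ toℚ b ℚ.* (ℤ.+ 1 ℚ./ d)
toℚ≤toℚ*1/ a {b} d@(suc d′) a*d≤b =
  ℚ.toℚᵘ-cancel-≤ (ℚᵘ.≤-respˡ-≃ (ℚᵘ.≃-sym (toℚᵘ-toℚ a)) (ℚᵘ.≤-respʳ-≃ (ℚᵘ.≃-sym b*1/d≃)
    (*≤* (subst₂ ℤ._≤_ a*[1*d]≡ (sym (trans (ℤ.*-identityʳ _) (ℤ.*-identityʳ _))) (ℤ.+≤+ a*d≤b)))))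
  where
  b*1/d≃ : toℚᵘ (toℚ b ℚ.* (ℤ.+ 1 ℚ./ d)) ≃ᵘ mkℚᵘ (ℤ.+ b) 0 ℚᵘ.* mkℚᵘ (ℤ.+ 1) d′
  b*1/d≃ = ℚᵘ.≃-trans (ℚ.toℚᵘ-homo-* (toℚ b) (ℤ.+ 1 ℚ./ d))
                      (ℚᵘ.*-cong (toℚᵘ-toℚ b) (ℚ.toℚᵘ-fromℚᵘ (mkℚᵘ (ℤ.+ 1) d′)))
  a*[1*d]≡ : ℤ.+ (a * d) ≡ ℤ.+ a ℤ.* ℤ.+ (1 * d)
  a*[1*d]≡ = trans (cong (λ t → ℤ.+ (a * t)) (sym (*-identityˡ d))) (ℤ.pos-* a (1 * d))

∑-toℚ≤*Z : ∀ s A (t : ℕ → ℕ) M → (∀ j → t j * suc j ^ s ≤ A) →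
           toℚ (∑[ j < M ] t j) ℚ.≤ toℚ A ℚ.* Z s M
∑-toℚ≤*Z s A t zero    t≤ = ℚ.≤-reflexive (sym (ℚ.*-zeroʳ (toℚ A)))
∑-toℚ≤*Z s A t (suc M) t≤ = begin
  toℚ (∑[ j < suc M ] t j)
    ≡⟨ cong toℚ (∑<-init-last M t) ⟩
  toℚ (∑[ j < M ] t j + t M)
    ≡⟨ toℚ-+ (∑[ j < M ] t j) (t M) ⟩
  toℚ (∑[ j < M ] t j) ℚ.+ toℚ (t M)
    ≤⟨ ℚ.+-mono-≤ (∑-toℚ≤*Z s A t M t≤) (toℚ≤toℚ*1/ (t M) (suc M ^ s) (t≤ M)) ⟩
  toℚ A ℚ.* Z s M ℚ.+ toℚ A ℚ.* (ℤ.+ 1 ℚ./ suc M ^ s)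
    ≡⟨ ℚ.*-distribˡ-+ (toℚ A) _ _ ⟨
  toℚ A ℚ.* Z s (suc M) ∎
  where
  instance _ = m^n≢0 (suc M) s
  open ℚ.≤-Reasoning

p≤p+q : ∀ p q .{{_ : ℚ.NonNegative q}} → p ℚ.≤ p ℚ.+ q
p≤p+q p q = ℚ.≤-trans (ℚ.≤-reflexive (sym (ℚ.+-identityʳ p))) (ℚ.+-monoʳ-≤ p (ℚ.nonNegative⁻¹ q))

module _ (s M : ℕ) where
  private instance
    _ = m^n≢0 (suc M) s

  1/[1+M]^s-nonNeg : ℚ.NonNegative (ℤ.+ 1 ℚ./ suc M ^ s)
  1/[1+M]^s-nonNeg = ℚ.normalize-nonNeg 1 (suc M ^ s)

  Z≤Z-suc : Z s M ℚ.≤ Z s (suc M)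
  Z≤Z-suc = p≤p+q (Z s M) _ {{1/[1+M]^s-nonNeg}}

Z-nonNeg : ∀ s M → ℚ.NonNegative (Z s M)
Z-nonNeg s zero    = _
Z-nonNeg s (suc M) = ℚ.nonNeg+nonNeg⇒nonNeg (Z s M) {{Z-nonNeg s M}} _ {{1/[1+M]^s-nonNeg s M}}

1≤Z : ∀ s M → ℚ.1ℚ ℚ.≤ Z s (suc M)
1≤Z s zero    = ℚ.≤-reflexive (sym (trans (ℚ.+-identityˡ _) (1/d≡1 (1 ^ s) {{m^n≢0 1 s}} (^-zeroˡ s))))
  where
  1/d≡1 : ∀ d .{{_ : NonZero d}} → d ≡ 1 → ℤ.+ 1 ℚ./ d ≡ ℚ.1ℚ
  1/d≡1 .1 refl = refl
1≤Z s (suc M) = ℚ.≤-trans (1≤Z s M) (Z≤Z-suc s (suc M))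

Z≤Z*Z : ∀ s M → Z s (suc M) ℚ.≤ Z s (suc M) ℚ.* Z s (suc M)
Z≤Z*Z s M = ℚ.≤-trans (ℚ.≤-reflexive (sym (ℚ.*-identityʳ (Z s (suc M)))))
                      (ℚ.*-monoˡ-≤-nonNeg (Z s (suc M)) {{Z-nonNeg s (suc M)}} (1≤Z s M))

γ≤m^k*Z : ∀ k m n .{{_ : NonZero m}} .{{_ : NonZero n}} → toℚ (γ (suc k) m n) ℚ.≤ toℚ (m ^ suc k) ℚ.* Z k m
γ≤m^k*Z k m n = begin
  toℚ (γ (suc k) m n)
    ≤⟨ toℚ-mono-≤ (γ≤∑-orders (suc k) m n) ⟩
  toℚ (∑[ s < m ] (suc s * (m / suc s) ^ suc k))
    ≤⟨ ∑-toℚ≤*Z k (m ^ suc k) (λ s → suc s * (m / suc s) ^ suc k) m (λ s → d*[m/d]^[1+k]*d^k≤m^[1+k] k m (suc s)) ⟩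
  toℚ (m ^ suc k) ℚ.* Z k m ∎
  where open ℚ.≤-Reasoning

-- The hypothesis 3 ≤ k is only used as k ≥ 1.
proposition3p8 : (k m n : ℕ) .{{_ : NonZero m}} .{{_ : NonZero n}} → 3 ≤ k →
    (m ^ k ≤ γ k m n)
    × ((ε : ℚ) → Positive ε →
        ∃[ M ] (toℚ (γ k m n) ℚ.≤ (toℚ (m ^ k) ℚ.* (Z (k ∸ 1) M ℚ.* Z (k ∸ 1) M)) ℚ.+ ε))
proposition3p8 k@(suc k′) m@(suc m′) n (s≤s _) = m^k≤γ k m n , λ ε ε>0 → m , (begin
  toℚ (γ k m n)                              ≤⟨ γ≤m^k*Z k′ m n ⟩
  toℚ (m ^ k) ℚ.* Z k′ m                     ≤⟨ ℚ.*-monoˡ-≤-nonNeg (toℚ (m ^ k)) {{m^k≥0}} (Z≤Z*Z k′ m′) ⟩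
  toℚ (m ^ k) ℚ.* (Z k′ m ℚ.* Z k′ m)        ≤⟨ p≤p+q _ ε {{ℚ.pos⇒nonNeg ε {{ε>0}}}} ⟩
  toℚ (m ^ k) ℚ.* (Z k′ m ℚ.* Z k′ m) ℚ.+ ε  ∎)
  where
  open ℚ.≤-Reasoning
  m^k≥0 : ℚ.NonNegative (toℚ (m ^ k))
  m^k≥0 = ℚ.normalize-nonNeg (m ^ k) 1
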